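{- Let $f,g,s,z$ be distinct alternatives and let $\mathcal D\subseteq\mathcal L(\{f,g,s,z\})$ be a peak-pit Condorcet domain with $R=fsgz\in\mathcal D$ and $T=zgsf\in\mathcal D$ such that $gN_{\{f,g,z\}}1\in N_p(\mathcal D_{\{f,g,z\}})$. Let $\mathcal G=(G_1,\dots,G_k)$ be a geodesic on $\mathcal L(\{f,g,s\})$ connecting $R_{\{f,g,s\}}$ and $T_{\{f,g,s\}}$ such that $\mathcal D_{\{f,g,s\}}\cup\{G_1,\dots,G_k\}$ is a peak-pit Condorcet domain. Then (a) if $(f,s)\vartriangleleft(f,g)\vartriangleleft(s,g)$ in $S(\mathcal G)$, then $gN_{\{g,s,z\}}1\in N_p(\mathcal D_{\{g,s,z\}})$; (b) if $(s,g)\vartriangleleft(f,g)\vartriangleleft(f,s)$ in $S(\mathcal G)$, then $sN_{\{f,s,z\}}1\in N_p(\mathcal D_{\{f,s,z\}})$.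
   Context: Linear orders are written as words from top to bottom; $\mathcal D_B$ is the set of restrictions of orders of $\mathcal D$ to $B$. For distinct $p,q,r$, $x\in\{p,q,r\}$, $k\in\{1,2,3\}$, a domain satisfies the never-condition $xN_{\{p,q,r\}}k$ if none of its orders restricted to $\{p,q,r\}$ has $x$ in position $k$; those with $k=1$ (never-top) or $k=3$ (never-bottom) are peak-pit conditions, and $N_p(\cdot)$ is the set of peak-pit conditions satisfied. A peak-pit Condorcet domain is a domain whose restriction to every triple of distinct alternatives satisfies at least one peak-pit condition. Two orders are alike if they differ by swapping two adjacent alternatives $x,y$ (unordered switching pair $(x,y)$); a geodesic is a path of alike orders of minimum length between its endpoints, $S(\mathcal G)$ is its sequence of switching pairs (each occurring once), and $p\vartriangleleft q$ means $p$ occurs before $q$ in $S(\mathcal G)$. -}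

module Defs where

open import Data.Nat using (ℕ; zero; suc; _<_)
open import Data.Fin using (Fin)
open import Data.Fin.Properties using (_≟_)
open import Data.List using (List; []; _∷_; _++_; filter; length; head; last)
open import Data.List.Membership.DecPropositional (_≟_ {4}) using (_∈_; _∈?_)
open import Data.List.Relation.Binary.Permutation.Propositional using (_↭_)
open import Data.Product using (Σ; ∃; _×_; _,_)
open import Data.Sum using (_⊎_)
open import Data.Maybe using (Maybe; just)
open import Relation.Binary.PropositionalEquality using (_≡_; _≢_)
open import Relation.Nullary using (¬_)
import Data.List.Membership.Propositional as PM

-- The four alternatives live in Fin 4 (any 4-element set of alternatives).
Alt : Set
Alt = Fin 4

-- A linear order is written as a word from top to bottom.
Order : Set
Order = List Alt

Domain : Set₁
Domain = Order → Set

-- w is a linear order on the (duplicate-free) ground set A.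
LinOrd : List Alt → Order → Set
LinOrd A w = w ↭ A

restrict : List Alt → Order → Order
restrict B w = filter (λ a → a ∈? B) w

restrictDom : List Alt → Domain → Domain
restrictDom B D w' = ∃ λ w → D w × restrict B w ≡ w'

-- AtPos w k x : x is in position k (1-based, from the top) of w.
AtPos : Order → ℕ → Alt → Set
AtPos []       _             x = ⊥' where open import Data.Empty renaming (⊥ to ⊥')
AtPos (y ∷ ys) zero          x = ⊥' where open import Data.Empty renaming (⊥ to ⊥')
AtPos (y ∷ ys) (suc zero)    x = y ≡ x
AtPos (y ∷ ys) (suc (suc k)) x = AtPos ys (suc k) x

Never : Domain → Alt → Alt → Alt → Alt → ℕ → Set
Never D x p q r k = ∀ w → D w → ¬ AtPos (restrict (p ∷ q ∷ r ∷ []) w) k x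

Distinct3 : Alt → Alt → Alt → Set
Distinct3 p q r = p ≢ q × p ≢ r × q ≢ r

-- Peak-pit condition (never-top k = 1 or never-bottom k = 3) on triple {p,q,r}.
PeakPitOn : Domain → Alt → Alt → Alt → Set
PeakPitOn D p q r =
  ∃ λ x → ∃ λ k → x ∈ (p ∷ q ∷ r ∷ []) × (k ≡ 1 ⊎ k ≡ 3) × Never D x p q r k

PeakPitCD : List Alt → Domain → Set
PeakPitCD A D =
  (∀ w → D w → LinOrd A w) ×
  (∀ p q r → p ∈ A → q ∈ A → r ∈ A → Distinct3 p q r → PeakPitOn D p q r)

AlikeVia : Order → Order → Alt → Alt → Set
AlikeVia w w' x y =
  Σ (List Alt) λ as → Σ (List Alt) λ bs →
    (w ≡ as ++ x ∷ y ∷ bs) × (w' ≡ as ++ y ∷ x ∷ bs)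

data Walk : List Order → List (Alt × Alt) → Set where
  single : ∀ {w} → Walk (w ∷ []) []
  step   : ∀ {w w' ws S x y} → AlikeVia w w' x y → Walk (w' ∷ ws) S →
           Walk (w ∷ w' ∷ ws) ((x , y) ∷ S)

PathOn : List Alt → Order → Order → List Order → Set
PathOn A a b G =
  (∃ λ S → Walk G S) × (∀ w → w PM.∈ G → LinOrd A w) ×
  head G ≡ just a × last G ≡ just b

Geodesic : List Alt → Order → Order → List Order → Set
Geodesic A a b G =
  PathOn A a b G × (∀ G' → PathOn A a b G' → length G Data.Nat.≤ length G')
  where import Data.Nat

-- The unordered pair {a,b} is the i-th entry (0-based) of S.
PairAt : List (Alt × Alt) → ℕ → Alt → Alt → Set
PairAt []             _       a b = ⊥' where open import Data.Empty renaming (⊥ to ⊥')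
PairAt ((x , y) ∷ S) zero    a b = (x ≡ a × y ≡ b) ⊎ (x ≡ b × y ≡ a)
PairAt (_ ∷ S)       (suc i) a b = PairAt S i a b

Before : List (Alt × Alt) → Alt → Alt → Alt → Alt → Set
Before S a b c d = ∃ λ i → ∃ λ j → i < j × PairAt S i a b × PairAt S j c d

_∪L_ : Domain → List Order → Domain
(D ∪L G) w = D w ⊎ w PM.∈ G

{-# OPTIONS --safe #-}
-- A geodesic from fsg to gsf on L({f,g,s}) runs round half of the hexagon, through
-- sfg and sgf or through fgs and gfs; the precedence hypothesis selects the first
-- route in (a) and the second in (b).  Its endpoints are mutually reverse with s in
-- the middle, so they violate every peak-pit condition on f and g, and the inner
-- order sfg (resp. fgs) violates "s never top" (resp. "s never bottom"); hence no
-- order of D has s at the bottom (resp. top) of {f,g,s}.  In (a), an order with g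
-- above s and z, but by hypothesis not above both f and z, has f above g above s;
-- in (b), an order with s above f and z has s above g too, since g lies below f or z.
module Submission where

open import Defs
open import Data.Nat using (ℕ; zero; suc; _≤_; s≤s)
open import Data.Fin.Properties using (_≟_)
open import Data.List using (List; []; _∷_; _++_; _∷ʳ_; length; last)
open import Data.List.Properties using (filter-accept; filter-reject; filter-idem; filter-all; filter-++)
open import Data.List.Relation.Unary.Any using (here; there)
open import Data.List.Relation.Unary.All using (All; []; _∷_)
open import Data.List.Relation.Unary.All.Properties using (All¬⇒¬Any)
open import Data.List.Relation.Binary.Permutation.Propositional using (_↭_; ↭-refl; ↭-prep; ↭-swap; ↭-trans; ↭-sym)
open import Data.List.Relation.Binary.Permutation.Propositional.Properties using (∈-resp-↭; drop-∷)
open import Data.List.Membership.DecPropositional (_≟_ {4}) using (_∈_; _∉_; _∈?_)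
import Data.List.Membership.Propositional as PM
open import Data.Maybe using (just)
open import Data.Product using (∃; _×_; _,_; map)
open import Data.Sum using (_⊎_; inj₁; inj₂)
open import Data.Empty using (⊥-elim)
open import Function using (_∘_; id)
open import Relation.Nullary using (¬_; yes; no)
open import Relation.Binary.PropositionalEquality using (_≡_; _≢_; refl; sym; subst; subst₂; cong₂; module ≡-Reasoning)

pattern ∈₁ = here refl
pattern ∈₂ = there ∈₁
pattern ∈₃ = there ∈₂
pattern ∈₄ = there ∈₃

variable
  a b c p q r x : Alt
  k : ℕ
  w : Order
  A B : List Alt
  G : List Order
  S : List (Alt × Alt)
  D U : Domain

restrict-∈ : a ∈ B → restrict B (a ∷ w) ≡ a ∷ restrict B w
restrict-∈ {B = B} = filter-accept (_∈? B)

restrict-∉ : a ∉ B → restrict B (a ∷ w) ≡ restrict B w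
restrict-∉ {B = B} = filter-reject (_∈? B)

restrict-idem : ∀ B w → restrict B (restrict B w) ≡ restrict B w
restrict-idem B = filter-idem (_∈? B)

restrict-⊆ : All (_∈ B) w → restrict B w ≡ w
restrict-⊆ {B = B} = filter-all (_∈? B)

Top : List Alt → Order → Alt → Set
Top B w x = AtPos (restrict B w) 1 x

Top-∷-∈⁺ : ∀ B → a ∈ B → Top B (a ∷ w) a
Top-∷-∈⁺ _ a∈B = subst (λ v → AtPos v 1 _) (sym (restrict-∈ a∈B)) refl

Top-∷-∈⁻ : ∀ B → a ∈ B → Top B (a ∷ w) x → a ≡ x
Top-∷-∈⁻ _ a∈B = subst (λ v → AtPos v 1 _) (restrict-∈ a∈B)

Top-∷-∉ : ∀ B → a ∉ B → Top B (a ∷ w) x → Top B w x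
Top-∷-∉ _ a∉B = subst (λ v → AtPos v 1 _) (restrict-∉ a∉B)

Top-sole : ∀ B → x ∈ w → x ∈ B → (∀ {y} → y ∈ w → y ∈ B → y ≡ x) → Top B w x
Top-sole B ∈₁ x∈B sole = Top-∷-∈⁺ B x∈B
Top-sole {w = a ∷ w} B (there x∈w) x∈B sole with a ∈? B
... | yes a∈B = sole ∈₁ a∈B
... | no _    = Top-sole B x∈w x∈B (sole ∘ there)

AtPos-∷ : ∀ B → a ∈ B → AtPos (restrict B w) (suc k) x → AtPos (restrict B (a ∷ w)) (suc (suc k)) x
AtPos-∷ _ a∈B = subst (λ v → AtPos v _ _) (sym (restrict-∈ a∈B))

Never⇒¬AtPos : Never U x p q r k → U w → All (_∈ p ∷ q ∷ r ∷ []) w → ¬ AtPos w k x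
Never⇒¬AtPos never Uw w⊆ =
  never _ Uw ∘ subst (λ v → AtPos v _ _) (sym (restrict-⊆ w⊆))

Never-restrictDom⁺ : Never D x p q r k → Never (restrictDom (p ∷ q ∷ r ∷ []) D) x p q r k
Never-restrictDom⁺ never _ (w , Dw , refl) =
  never w Dw ∘ subst (λ v → AtPos v _ _) (restrict-idem _ w)

Never-restrictDom⁻ : Never (restrictDom (p ∷ q ∷ r ∷ []) D) x p q r k → Never D x p q r k
Never-restrictDom⁻ never w Dw =
  never _ (w , Dw , refl) ∘ subst (λ v → AtPos v _ _) (sym (restrict-idem _ w))

reversal-leaves-middle : PeakPitOn U p q r → U (p ∷ r ∷ q ∷ []) → U (q ∷ r ∷ p ∷ []) →
  Never U r p q r 1 ⊎ Never U r p q r 3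
reversal-leaves-middle (_ , _ , ∈₁ , inj₁ refl , n) prq _ = ⊥-elim (Never⇒¬AtPos n prq (∈₁ ∷ ∈₃ ∷ ∈₂ ∷ []) refl)
reversal-leaves-middle (_ , _ , ∈₁ , inj₂ refl , n) _ qrp = ⊥-elim (Never⇒¬AtPos n qrp (∈₂ ∷ ∈₃ ∷ ∈₁ ∷ []) refl)
reversal-leaves-middle (_ , _ , ∈₂ , inj₁ refl , n) _ qrp = ⊥-elim (Never⇒¬AtPos n qrp (∈₂ ∷ ∈₃ ∷ ∈₁ ∷ []) refl)
reversal-leaves-middle (_ , _ , ∈₂ , inj₂ refl , n) prq _ = ⊥-elim (Never⇒¬AtPos n prq (∈₁ ∷ ∈₃ ∷ ∈₂ ∷ []) refl)
reversal-leaves-middle (_ , _ , ∈₃ , inj₁ refl , n) _ _ = inj₁ n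
reversal-leaves-middle (_ , _ , ∈₃ , inj₂ refl , n) _ _ = inj₂ n

data Walk₃ : Alt → Alt → Alt → List Order → List (Alt × Alt) → Set where
  stop   : Walk₃ a b c ((a ∷ b ∷ c ∷ []) ∷ []) []
  swap₁₂ : Walk₃ b a c G S → Walk₃ a b c ((a ∷ b ∷ c ∷ []) ∷ G) ((a , b) ∷ S)
  swap₂₃ : Walk₃ a c b G S → Walk₃ a b c ((a ∷ b ∷ c ∷ []) ∷ G) ((b , c) ∷ S)

walk₃ : Walk ((a ∷ b ∷ c ∷ []) ∷ G) S → Walk₃ a b c ((a ∷ b ∷ c ∷ []) ∷ G) S
walk₃ single                                = stop
walk₃ (step ([] , _ , refl , refl) W)       = swap₁₂ (walk₃ W)
walk₃ (step (_ ∷ [] , _ , refl , refl) W)   = swap₂₃ (walk₃ W)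
walk₃ (step (_ ∷ _ ∷ [] , _ , () , _) _)
walk₃ (step (_ ∷ _ ∷ _ ∷ [] , _ , () , _) _)
walk₃ (step (_ ∷ _ ∷ _ ∷ _ ∷ _ , _ , () , _) _)

data TripleReversal (a b c : Alt) : List Order → List (Alt × Alt) → Set where
  via-bac : TripleReversal a b c
    ((a ∷ b ∷ c ∷ []) ∷ (b ∷ a ∷ c ∷ []) ∷ (b ∷ c ∷ a ∷ []) ∷ (c ∷ b ∷ a ∷ []) ∷ [])
    ((a , b) ∷ (a , c) ∷ (b , c) ∷ [])
  via-acb : TripleReversal a b c
    ((a ∷ b ∷ c ∷ []) ∷ (a ∷ c ∷ b ∷ []) ∷ (c ∷ a ∷ b ∷ []) ∷ (c ∷ b ∷ a ∷ []) ∷ [])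
    ((b , c) ∷ (a , c) ∷ (a , b) ∷ [])

reversal-walks : Distinct3 a b c → Walk₃ a b c G S → length G ≤ 4 → last G ≡ just (c ∷ b ∷ a ∷ []) →
  TripleReversal a b c G S
reversal-walks _ (swap₁₂ (swap₂₃ (swap₁₂ stop))) _ _ = via-bac
reversal-walks _ (swap₂₃ (swap₁₂ (swap₂₃ stop))) _ _ = via-acb
reversal-walks {G = _ ∷ _ ∷ _ ∷ _ ∷ _ ∷ _} _ _ (s≤s (s≤s (s≤s (s≤s ())))) _
reversal-walks (_ , a≢c , _) stop _ refl = ⊥-elim (a≢c refl)
reversal-walks (_ , _ , b≢c) (swap₁₂ stop) _ refl = ⊥-elim (b≢c refl)
reversal-walks (_ , a≢c , _) (swap₂₃ stop) _ refl = ⊥-elim (a≢c refl)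
reversal-walks (_ , a≢c , _) (swap₁₂ (swap₁₂ stop)) _ refl = ⊥-elim (a≢c refl)
reversal-walks (_ , _ , b≢c) (swap₁₂ (swap₂₃ stop)) _ refl = ⊥-elim (b≢c refl)
reversal-walks (a≢b , _ , _) (swap₂₃ (swap₁₂ stop)) _ refl = ⊥-elim (a≢b refl)
reversal-walks (_ , a≢c , _) (swap₂₃ (swap₂₃ stop)) _ refl = ⊥-elim (a≢c refl)
reversal-walks (_ , _ , b≢c) (swap₁₂ (swap₁₂ (swap₁₂ stop))) _ refl = ⊥-elim (b≢c refl)
reversal-walks (_ , a≢c , _) (swap₁₂ (swap₁₂ (swap₂₃ stop))) _ refl = ⊥-elim (a≢c refl)
reversal-walks (_ , _ , b≢c) (swap₁₂ (swap₂₃ (swap₂₃ stop))) _ refl = ⊥-elim (b≢c refl)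
reversal-walks (_ , a≢c , _) (swap₂₃ (swap₁₂ (swap₁₂ stop))) _ refl = ⊥-elim (a≢c refl)
reversal-walks (_ , _ , b≢c) (swap₂₃ (swap₂₃ (swap₁₂ stop))) _ refl = ⊥-elim (b≢c refl)
reversal-walks (_ , a≢c , _) (swap₂₃ (swap₂₃ (swap₂₃ stop))) _ refl = ⊥-elim (a≢c refl)

reversal-path : a ∷ b ∷ c ∷ [] ↭ A →
  PathOn A (a ∷ b ∷ c ∷ []) (c ∷ b ∷ a ∷ [])
    ((a ∷ b ∷ c ∷ []) ∷ (b ∷ a ∷ c ∷ []) ∷ (b ∷ c ∷ a ∷ []) ∷ (c ∷ b ∷ a ∷ []) ∷ [])
reversal-path {a} {b} {c} {A} abc↭A =
  (_ , step ([] , _ , refl , refl) (step (_ ∷ [] , _ , refl , refl) (step ([] , _ , refl , refl) single)))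
  , linear , refl , refl
  where
  bac↭A : b ∷ a ∷ c ∷ [] ↭ A
  bac↭A = ↭-trans (↭-swap b a ↭-refl) abc↭A
  bca↭A : b ∷ c ∷ a ∷ [] ↭ A
  bca↭A = ↭-trans (↭-prep b (↭-swap c a ↭-refl)) bac↭A
  cba↭A : c ∷ b ∷ a ∷ [] ↭ A
  cba↭A = ↭-trans (↭-swap c b ↭-refl) bca↭A
  linear : ∀ w → w PM.∈ _ → LinOrd A w
  linear _ ∈₁ = abc↭A
  linear _ ∈₂ = bac↭A
  linear _ ∈₃ = bca↭A
  linear _ ∈₄ = cba↭A

reversal-geodesic : Distinct3 a b c → a ∷ b ∷ c ∷ [] ↭ A →
  Geodesic A (a ∷ b ∷ c ∷ []) (c ∷ b ∷ a ∷ []) G → Walk G S → TripleReversal a b c G S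
reversal-geodesic {G = []} _ _ ((_ , _ , () , _) , _) _
reversal-geodesic {G = _ ∷ _} distinct abc↭A ((_ , _ , refl , end) , shortest) W =
  reversal-walks distinct (walk₃ W) (shortest _ (reversal-path abc↭A)) end

Before-∷ʳ⁻ : ∀ S {t a b c d} → Before (S ∷ʳ t) a b c d → ∃ λ i → PairAt S i a b
Before-∷ʳ⁻ []      (zero  , zero  , () , _)
Before-∷ʳ⁻ []      (zero  , suc _ , _ , _ , ())
Before-∷ʳ⁻ []      (suc _ , _ , _ , () , _)
Before-∷ʳ⁻ (_ ∷ _) (zero  , _ , _ , ab , _) = zero , ab
Before-∷ʳ⁻ (_ ∷ _) (suc _ , zero , () , _)
Before-∷ʳ⁻ (_ ∷ S) (suc i , suc j , s≤s i<j , ab , cd) = map suc id (Before-∷ʳ⁻ S (i , j , i<j , ab , cd))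

module FourAlternatives {f g s z : Alt}
  (f≢g : f ≢ g) (f≢s : f ≢ s) (f≢z : f ≢ z) (g≢s : g ≢ s) (g≢z : g ≢ z) (s≢z : s ≢ z) where

  fgs fgz fsz gsz : List Alt
  fgs = f ∷ g ∷ s ∷ []
  fgz = f ∷ g ∷ z ∷ []
  fsz = f ∷ s ∷ z ∷ []
  gsz = g ∷ s ∷ z ∷ []

  f∉gsz : f ∉ gsz
  f∉gsz = All¬⇒¬Any (f≢g ∷ f≢s ∷ f≢z ∷ [])

  z∉fgs : z ∉ fgs
  z∉fgs = All¬⇒¬Any ((f≢z ∘ sym) ∷ (g≢z ∘ sym) ∷ (s≢z ∘ sym) ∷ [])

  restrict-fsgz : restrict fgs (f ∷ s ∷ g ∷ z ∷ []) ≡ f ∷ s ∷ g ∷ []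
  restrict-fsgz = begin
    restrict fgs ((f ∷ s ∷ g ∷ []) ++ z ∷ [])
      ≡⟨ filter-++ (_∈? fgs) (f ∷ s ∷ g ∷ []) (z ∷ []) ⟩
    restrict fgs (f ∷ s ∷ g ∷ []) ++ restrict fgs (z ∷ [])
      ≡⟨ cong₂ _++_ (restrict-⊆ (∈₁ ∷ ∈₃ ∷ ∈₂ ∷ [])) (restrict-∉ z∉fgs) ⟩
    f ∷ s ∷ g ∷ [] ∎
    where open ≡-Reasoning

  restrict-zgsf : restrict fgs (z ∷ g ∷ s ∷ f ∷ []) ≡ g ∷ s ∷ f ∷ []
  restrict-zgsf = begin
    restrict fgs (z ∷ g ∷ s ∷ f ∷ [])  ≡⟨ restrict-∉ z∉fgs ⟩
    restrict fgs (g ∷ s ∷ f ∷ [])      ≡⟨ restrict-⊆ (∈₂ ∷ ∈₃ ∷ ∈₁ ∷ []) ⟩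
    g ∷ s ∷ f ∷ [] ∎
    where open ≡-Reasoning

  s-second-of-fgs : w ↭ gsz → Top gsz w g → AtPos (restrict fgs w) 2 s
  s-second-of-fgs {[]} _ ()
  s-second-of-fgs {a ∷ w} a∷w↭ top with ∈-resp-↭ a∷w↭ ∈₁
  ... | ∈₁ = AtPos-∷ fgs ∈₂ (Top-sole fgs (∈-resp-↭ (↭-sym w↭sz) ∈₁) ∈₃ only-s)
    where
    w↭sz : w ↭ s ∷ z ∷ []
    w↭sz = drop-∷ a∷w↭
    only-s : ∀ {y} → y ∈ w → y ∈ fgs → y ≡ s
    only-s y∈w y∈fgs with ∈-resp-↭ w↭sz y∈w
    ... | ∈₁ = refl
    ... | ∈₂ = ⊥-elim (z∉fgs y∈fgs)
  ... | ∈₂ = ⊥-elim (g≢s (sym (Top-∷-∈⁻ gsz ∈₂ top)))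
  ... | ∈₃ = ⊥-elim (g≢z (sym (Top-∷-∈⁻ gsz ∈₃ top)))

  s-bottom-of-fgs : w ↭ f ∷ g ∷ s ∷ z ∷ [] → Top gsz w g → ¬ Top fgz w g →
    AtPos (restrict fgs w) 3 s
  s-bottom-of-fgs {[]} _ ()
  s-bottom-of-fgs {a ∷ w} a∷w↭ top ¬top with ∈-resp-↭ a∷w↭ ∈₁
  ... | ∈₁ = AtPos-∷ fgs ∈₁ (s-second-of-fgs (drop-∷ a∷w↭) (Top-∷-∉ gsz f∉gsz top))
  ... | ∈₂ = ⊥-elim (¬top (Top-∷-∈⁺ fgz ∈₂))
  ... | ∈₃ = ⊥-elim (g≢s (sym (Top-∷-∈⁻ gsz ∈₂ top)))
  ... | ∈₄ = ⊥-elim (g≢z (sym (Top-∷-∈⁻ gsz ∈₃ top)))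

  s-top-of-fgs : w ↭ f ∷ g ∷ s ∷ z ∷ [] → Top fsz w s → ¬ Top fgz w g → Top fgs w s
  s-top-of-fgs {[]} _ ()
  s-top-of-fgs {a ∷ w} a∷w↭ top ¬top with ∈-resp-↭ a∷w↭ ∈₁
  ... | ∈₁ = ⊥-elim (f≢s (Top-∷-∈⁻ fsz ∈₁ top))
  ... | ∈₂ = ⊥-elim (¬top (Top-∷-∈⁺ fgz ∈₂))
  ... | ∈₃ = Top-∷-∈⁺ fgs ∈₃
  ... | ∈₄ = ⊥-elim (s≢z (sym (Top-∷-∈⁻ fsz ∈₃ top)))

  module _ (D : Domain) where

    LinearOn : List Alt → Set
    LinearOn A = ∀ w → D w → LinOrd A w

    g-never-top-gsz : LinearOn (f ∷ g ∷ s ∷ z ∷ []) → Never D g f g z 1 → Never D s f g s 3 →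
      Never D g g s z 1
    g-never-top-gsz linear g-low s-high w Dw top = s-high w Dw (s-bottom-of-fgs (linear w Dw) top (g-low w Dw))

    s-never-top-fsz : LinearOn (f ∷ g ∷ s ∷ z ∷ []) → Never D g f g z 1 → Never D s f g s 1 →
      Never D s f s z 1
    s-never-top-fsz linear g-low s-low w Dw top = s-low w Dw (s-top-of-fgs (linear w Dw) top (g-low w Dw))

    s-never-bottom-fgs : TripleReversal f s g G S → Before S f s f g →
      PeakPitOn (restrictDom fgs D ∪L G) f g s → Never D s f g s 3
    s-never-bottom-fgs via-bac _ peak-pit with reversal-leaves-middle peak-pit (inj₂ ∈₁) (inj₂ ∈₄)
    ... | inj₁ never-top    = ⊥-elim (Never⇒¬AtPos never-top (inj₂ ∈₂) (∈₃ ∷ ∈₁ ∷ ∈₂ ∷ []) refl)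
    ... | inj₂ never-bottom = Never-restrictDom⁻ (λ w → never-bottom w ∘ inj₁)
    s-never-bottom-fgs via-acb fs◁fg _ = ⊥-elim (fs-only-last (Before-∷ʳ⁻ ((s , g) ∷ (f , g) ∷ []) fs◁fg))
      where
      fs-only-last : ¬ ∃ λ i → PairAt ((s , g) ∷ (f , g) ∷ []) i f s
      fs-only-last (0 , inj₁ (s≡f , _)) = f≢s (sym s≡f)
      fs-only-last (0 , inj₂ (_ , g≡f)) = f≢g (sym g≡f)
      fs-only-last (1 , inj₁ (_ , g≡s)) = g≢s g≡s
      fs-only-last (1 , inj₂ (f≡s , _)) = f≢s f≡s

    s-never-top-fgs : TripleReversal f s g G S → Before S s g f g →
      PeakPitOn (restrictDom fgs D ∪L G) f g s → Never D s f g s 1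
    s-never-top-fgs via-acb _ peak-pit with reversal-leaves-middle peak-pit (inj₂ ∈₁) (inj₂ ∈₄)
    ... | inj₁ never-top    = Never-restrictDom⁻ (λ w → never-top w ∘ inj₁)
    ... | inj₂ never-bottom = ⊥-elim (Never⇒¬AtPos never-bottom (inj₂ ∈₂) (∈₁ ∷ ∈₂ ∷ ∈₃ ∷ []) refl)
    s-never-top-fgs via-bac sg◁fg _ = ⊥-elim (sg-only-last (Before-∷ʳ⁻ ((f , s) ∷ (f , g) ∷ []) sg◁fg))
      where
      sg-only-last : ¬ ∃ λ i → PairAt ((f , s) ∷ (f , g) ∷ []) i s g
      sg-only-last (0 , inj₁ (f≡s , _)) = f≢s f≡s
      sg-only-last (0 , inj₂ (f≡g , _)) = f≢g f≡g
      sg-only-last (1 , inj₁ (f≡s , _)) = f≢s f≡s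
      sg-only-last (1 , inj₂ (f≡g , _)) = f≢g f≡g

lemma19 : (f g s z : Alt) →
    f ≢ g → f ≢ s → f ≢ z → g ≢ s → g ≢ z → s ≢ z →
    (D : Domain) →
    PeakPitCD (f ∷ g ∷ s ∷ z ∷ []) D →
    D (f ∷ s ∷ g ∷ z ∷ []) →
    D (z ∷ g ∷ s ∷ f ∷ []) →
    Never (restrictDom (f ∷ g ∷ z ∷ []) D) g f g z 1 →
    (G : List Order) (S : List (Alt × Alt)) →
    Geodesic (f ∷ g ∷ s ∷ [])
      (restrict (f ∷ g ∷ s ∷ []) (f ∷ s ∷ g ∷ z ∷ []))
      (restrict (f ∷ g ∷ s ∷ []) (z ∷ g ∷ s ∷ f ∷ [])) G →
    Walk G S →
    PeakPitCD (f ∷ g ∷ s ∷ []) (restrictDom (f ∷ g ∷ s ∷ []) D ∪L G) →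
    ((Before S f s f g × Before S f g s g) →
       Never (restrictDom (g ∷ s ∷ z ∷ []) D) g g s z 1) ×
    ((Before S s g f g × Before S f g f s) →
       Never (restrictDom (f ∷ s ∷ z ∷ []) D) s f s z 1)
lemma19 f g s z f≢g f≢s f≢z g≢s g≢z s≢z D (linear , _) _ _ g-not-top-fgz G S geodesic W (_ , peak-pit-on) =
    (λ (fs◁fg , _) → Never-restrictDom⁺
       (g-never-top-gsz D linear g-low (s-never-bottom-fgs D route fs◁fg peak-pit)))
  , (λ (sg◁fg , _) → Never-restrictDom⁺
       (s-never-top-fsz D linear g-low (s-never-top-fgs D route sg◁fg peak-pit)))
  where
  open FourAlternatives f≢g f≢s f≢z g≢s g≢z s≢z

  g-low : Never D g f g z 1
  g-low = Never-restrictDom⁻ g-not-top-fgz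

  peak-pit : PeakPitOn (restrictDom fgs D ∪L G) f g s
  peak-pit = peak-pit-on f g s ∈₁ ∈₂ ∈₃ (f≢g , f≢s , g≢s)

  route : TripleReversal f s g G S
  route = reversal-geodesic (f≢s , f≢g , g≢s ∘ sym) (↭-prep f (↭-swap s g ↭-refl))
    (subst₂ (λ R T → Geodesic fgs R T G) restrict-fsgz restrict-zgsf geodesic) W
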